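{- Let $n\geq 5$ and let $G$ be a nontrivial connected spanning convex subgraph of $C_n^2$. Then there exist integers $j,k$ with $0\leq j\leq n-1$ and $0\leq k\leq\lceil\frac{n-2}{2}\rceil$ such that $G=S_{n,k,j}$.
   Context: For $n\geq 5$, the square cycle $C_n^2$ has vertex set $\mathbb{Z}_n=\mathbb{Z}/n\mathbb{Z}$, with $v_i=i+n\mathbb{Z}$ for $i\in\mathbb{Z}$, and edge set $\{\{v_i,v_j\}: i-j\in\{1,2\}\}$. For $i\in\mathbb{Z}$ write $e_i=\{v_i,v_{i+1}\}$ (frames) and $f_i=\{v_i,v_{i+2}\}$ (windows), indices modulo $n$. A spanning subgraph has vertex set all of $\mathbb{Z}_n$. The triangles are $T_i=\{e_i,e_{i+1},f_i\}$; a subgraph $G$ is convex if for every $i$, either $|T_i\cap E(G)|\leq1$ or $T_i\subseteq E(G)$. The trivial connected spanning subgraphs are $C_n^2$ itself and, when $n$ is odd, the graph $(\mathbb{Z}_n,\{f_0,\dots,f_{n-1}\})$; "nontrivial" means not one of these. For integers $j,k$ with $0\leq k\leq\lceil\frac{n-2}{2}\rceil$, $S_{n,k,j}$ is the graph with vertex set $\mathbb{Z}_n$ and edge set $E(C_n^2)\setminus\big(\{f_j,f_{j+2k+1}\}\cup\{e_{j+1},\dots,e_{j+2k+1}\}\big)$. -}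

module Defs where

open import Data.Nat using (ℕ; zero; suc; _+_; _≤_; _<_; NonZero)
open import Data.Nat.DivMod using (_mod_)
open import Data.Fin using (Fin; toℕ)
open import Data.Bool using (Bool; true; false; if_then_else_)
open import Data.Product using (Σ; ∃; _×_; _,_)
open import Data.Sum using (_⊎_)
open import Relation.Nullary using (¬_)
open import Relation.Binary.PropositionalEquality using (_≡_)

-- The vertex v_i (i ∈ ℤ) of C_n^2 is i mod n; we only need i ∈ ℕ
-- (every residue class has a natural representative).
vtx : (n : ℕ) .{{_ : NonZero n}} → ℕ → Fin n
vtx n i = i mod n

-- Edges of C_n^2 (n ≥ 5): frames e_i = {v_i, v_{i+1}} and windows
-- f_i = {v_i, v_{i+2}}, for i ∈ ℤ_n.  For n ≥ 5 these 2n edges are pairwise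
-- distinct, so they are faithfully labelled by this data type.
data Edge (n : ℕ) : Set where
  frame  : Fin n → Edge n
  window : Fin n → Edge n

ends : (n : ℕ) .{{_ : NonZero n}} → Edge n → Fin n × Fin n
ends n (frame i)  = (i , vtx n (toℕ i + 1))
ends n (window i) = (i , vtx n (toℕ i + 2))

e : (n : ℕ) .{{_ : NonZero n}} → ℕ → Edge n
e n i = frame (vtx n i)

f : (n : ℕ) .{{_ : NonZero n}} → ℕ → Edge n
f n i = window (vtx n i)

-- A spanning subgraph of C_n^2: vertex set all of ℤ_n, given by its edge set
-- (a decidable subset of E(C_n^2)).
Subgraph : ℕ → Set
Subgraph n = Edge n → Bool

Adj : (n : ℕ) .{{_ : NonZero n}} → Subgraph n → Fin n → Fin n → Set
Adj n G u v = Σ (Edge n) λ x → G x ≡ true ×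
  ((ends n x ≡ (u , v)) ⊎ (ends n x ≡ (v , u)))

data Reach (n : ℕ) .{{_ : NonZero n}} (G : Subgraph n) : Fin n → Fin n → Set where
  here : ∀ {u} → Reach n G u u
  step : ∀ {u v w} → Adj n G u v → Reach n G v w → Reach n G u w

Connected : (n : ℕ) .{{_ : NonZero n}} → Subgraph n → Set
Connected n G = ∀ u v → Reach n G u v

b2n : Bool → ℕ
b2n true  = 1
b2n false = 0

triCount : (n : ℕ) .{{_ : NonZero n}} → Subgraph n → ℕ → ℕ
triCount n G i = b2n (G (e n i)) + b2n (G (e n (i + 1))) + b2n (G (f n i))

Convex : (n : ℕ) .{{_ : NonZero n}} → Subgraph n → Set
Convex n G = ∀ (i : ℕ) → triCount n G i ≤ 1 ⊎
  (G (e n i) ≡ true × G (e n (i + 1)) ≡ true × G (f n i) ≡ true)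

_≐_ : ∀ {n} → Subgraph n → Subgraph n → Set
G ≐ H = ∀ x → G x ≡ H x

fullGraph : (n : ℕ) → Subgraph n
fullGraph n _ = true

windowsOnly : (n : ℕ) → Subgraph n
windowsOnly n (frame _)  = false
windowsOnly n (window _) = true

Odd : ℕ → Set
Odd n = ∃ λ m → n ≡ suc (m + m)

Nontrivial : (n : ℕ) → Subgraph n → Set
Nontrivial n G = ¬ (G ≐ fullGraph n) × ¬ (Odd n × (G ≐ windowsOnly n))

RemovedS : (n : ℕ) .{{_ : NonZero n}} → (k j : ℕ) → Edge n → Set
RemovedS n k j x =
  x ≡ f n j ⊎ x ≡ f n (j + (k + k + 1)) ⊎
  (∃ λ t → 1 ≤ t × t ≤ k + k + 1 × x ≡ e n (j + t))

-- G = S_{n,k,j}  (S_{n,k,j} has edge set E(C_n^2) minus the removed edges)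
IsS : (n : ℕ) .{{_ : NonZero n}} → (k j : ℕ) → Subgraph n → Set
IsS n k j G = ∀ x → (G x ≡ true → ¬ RemovedS n k j x) × (¬ RemovedS n k j x → G x ≡ true)

{-# OPTIONS --safe #-}
-- If every frame is present, convexity adds every window and G = C_n^2. If no frame is present,
-- windows preserve parity, so n is odd, and the cut below leaves at most one window missing.
-- Otherwise take a maximal run e_{j+1}, …, e_{j+m} of missing frames; convexity removes f_j and
-- f_{j+m}. Connectivity is used through one kind of cut: a segment of the cycle together with
-- every other vertex of the runs of missing frames on either side of it. Such a cut exists if
-- m is even, if a window strictly inside the run is missing, or if there is a second run. So
-- m = 2k+1, the inner windows are present, all other frames are present, convexity supplies
-- the remaining windows, and G = S_{n,k,j}.
module Submission where

open import Defs
open import Data.Nat using (ℕ; zero; suc; pred; _+_; _∸_; _≤_; _<_; z≤n; s≤s; s≤s⁻¹; ⌈_/2⌉; NonZero; _≤?_; _<?_)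
open import Data.Nat.Properties
open import Data.Nat.DivMod using (_%_; m%n<n; m%n≤n; m<n⇒m%n≡m; n%n≡0; %-distribˡ-+; m%n%n≡m%n; [m+n]%n≡m%n)
open import Algebra.Properties.CommutativeSemigroup +-commutativeSemigroup using (x∙yz≈y∙xz)
open import Data.Fin using (Fin; toℕ)
open import Data.Fin.Properties using (toℕ-injective; toℕ-fromℕ<; toℕ<n; all?; any?; ¬∀⟶∃¬)
open import Data.Bool using (Bool; true; false; not; _xor_)
open import Data.Bool.Properties as Bool using (¬-not; not-involutive; xor-same)
open import Data.Product using (Σ; ∃; _×_; _,_; proj₁; proj₂)
open import Data.Sum using (_⊎_; inj₁; inj₂; [_,_]′)
open import Data.Empty using (⊥; ⊥-elim)
open import Relation.Nullary using (¬_; yes; no; contradiction)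
open import Relation.Unary using (Pred; Decidable)
open import Relation.Binary.PropositionalEquality
open import Relation.Binary.Definitions using (tri<; tri≈; tri>)

least-counterexample : ∀ {p} {P : Pred ℕ p} → Decidable P → ∀ N →
  (∀ i → i < N → P i) ⊎ ∃ λ k → k < N × ¬ P k × (∀ i → i < k → P i)
least-counterexample P? zero = inj₁ λ _ ()
least-counterexample P? (suc N) with least-counterexample P? N
... | inj₂ (k , k<N , ¬Pk , below) = inj₂ (k , m<n⇒m<1+n k<N , ¬Pk , below)
... | inj₁ below with P? N
...   | no ¬PN = inj₂ (N , ≤-refl , ¬PN , below)
...   | yes PN = inj₁ λ i i<1+N →
                   [ below i , (λ { refl → PN }) ]′ (m<1+n⇒m<n∨m≡n i<1+N)

<-or-≥ : ∀ m n → m < n ⊎ n ≤ m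
<-or-≥ m n with m <? n
... | yes m<n = inj₁ m<n
... | no m≮n = inj₂ (≮⇒≥ m≮n)

data Straddle (s x : ℕ) : Set where
  lies-below : suc (suc s) ≤ x → Straddle s x
  crosses    : suc s ≡ x → Straddle s x
  lies-above : x ≤ s → Straddle s x

straddle : ∀ s x → Straddle s x
straddle s x with <-or-≥ (suc s) x
... | inj₁ s+2≤x = lies-below s+2≤x
... | inj₂ x≤s+1 with m≤n⇒m<n∨m≡n x≤s+1
...   | inj₁ x≤s = lies-above (s≤s⁻¹ x≤s)
...   | inj₂ x≡s+1 = crosses (sym x≡s+1)

clash : ∀ {A : Set} {x : Bool} → x ≡ true → x ≡ false → A
clash refl ()

even : ℕ → Bool
even zero = true
even (suc zero) = false
even (suc (suc n)) = even n

even-suc : ∀ t → even (suc t) ≡ not (even t)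
even-suc zero = refl
even-suc (suc zero) = refl
even-suc (suc (suc t)) = even-suc t

even-pred : ∀ t {x} → even (suc t) ≡ x → even t ≡ not x
even-pred t eq = trans (sym (not-involutive (even t))) (cong not (trans (sym (even-suc t)) eq))

even-∸ : ∀ {t m} → t ≤ m → even t ≡ even m → even (m ∸ t) ≡ true
even-∸ {zero} _ eq = sym eq
even-∸ {suc zero} {suc m} _ eq = even-pred m (sym eq)
even-∸ {suc (suc t)} {suc (suc m)} (s≤s (s≤s t≤m)) eq = even-∸ {t} {m} t≤m eq

even-+-odd : ∀ a {c} → even c ≡ false → even (a + c) ≡ even (suc a)
even-+-odd zero eq = eq
even-+-odd (suc zero) {c} eq = trans (even-suc c) (cong not eq)
even-+-odd (suc (suc a)) eq = even-+-odd a eq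

even≡false⇒odd : ∀ m → even m ≡ false → ∃ λ k → m ≡ k + k + 1
even≡false⇒odd (suc zero) _ = 0 , refl
even≡false⇒odd (suc (suc m)) eq with even≡false⇒odd m eq
... | k , refl = suc k , cong suc (cong (_+ 1) (sym (+-suc k k)))

k≤⌈[n∸2]/2⌉ : ∀ {k n} → k + k < n → k ≤ ⌈ (n ∸ 2) /2⌉
k≤⌈[n∸2]/2⌉ {zero} _ = z≤n
k≤⌈[n∸2]/2⌉ {suc k} (s≤s (s≤s le)) =
  ≤-trans (≤-reflexive (n≡⌊n+n/2⌋ (suc k))) (⌊n/2⌋-mono (s≤s le))

convex-triangle-closed : ∀ {a b c} → b2n a + b2n b + b2n c ≤ 1 ⊎ (a ≡ true × b ≡ true × c ≡ true) →
  a ≡ true → b ≡ true → c ≡ true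
convex-triangle-closed {c = true} _ _ _ = refl
convex-triangle-closed {c = false} (inj₁ (s≤s ())) refl refl
convex-triangle-closed {c = false} (inj₂ (_ , _ , ())) _ _

convex-triangle-agree : ∀ {a b c} → b2n a + b2n b + b2n c ≤ 1 ⊎ (a ≡ true × b ≡ true × c ≡ true) →
  c ≡ true → a ≡ b
convex-triangle-agree {true} {true} _ _ = refl
convex-triangle-agree {false} {false} _ _ = refl
convex-triangle-agree {true} {false} (inj₁ (s≤s ())) refl
convex-triangle-agree {true} {false} (inj₂ (_ , () , _)) _
convex-triangle-agree {false} {true} (inj₁ (s≤s ())) refl
convex-triangle-agree {false} {true} (inj₂ (() , _ , _)) _

module Modular (n : ℕ) .{{_ : NonZero n}} where

  toℕ-vtx : ∀ i → toℕ (vtx n i) ≡ i % n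
  toℕ-vtx i = toℕ-fromℕ< (m%n<n i n)

  vtx-≡ : ∀ {i j} → i % n ≡ j % n → vtx n i ≡ vtx n j
  vtx-≡ eq = toℕ-injective (trans (toℕ-vtx _) (trans eq (sym (toℕ-vtx _))))

  vtx-toℕ : ∀ v → vtx n (toℕ v) ≡ v
  vtx-toℕ v = toℕ-injective (trans (toℕ-vtx _) (m<n⇒m%n≡m (toℕ<n v)))

  %-absorbˡ : ∀ x y → (x % n + y) % n ≡ (x + y) % n
  %-absorbˡ x y = begin
    (x % n + y) % n           ≡⟨ %-distribˡ-+ (x % n) y n ⟩
    (x % n % n + y % n) % n   ≡⟨ cong (λ z → (z + y % n) % n) (m%n%n≡m%n x n) ⟩
    (x % n + y % n) % n       ≡⟨ sym (%-distribˡ-+ x y n) ⟩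
    (x + y) % n               ∎
    where open ≡-Reasoning

  %-absorbʳ : ∀ x y → (x + y % n) % n ≡ (x + y) % n
  %-absorbʳ x y = begin
    (x + y % n) % n  ≡⟨ cong (_% n) (+-comm x (y % n)) ⟩
    (y % n + x) % n  ≡⟨ %-absorbˡ y x ⟩
    (y + x) % n      ≡⟨ cong (_% n) (+-comm y x) ⟩
    (x + y) % n      ∎
    where open ≡-Reasoning

  -- the position s < n of i as seen from b, i.e. v_i = v_{b+s}
  pos : ℕ → ℕ → ℕ
  pos b i = (i + (n ∸ b % n)) % n

  pos<n : ∀ b i → pos b i < n
  pos<n b i = m%n<n _ n

  b+[n∸b%n]%n≡0 : ∀ b → (b + (n ∸ b % n)) % n ≡ 0
  b+[n∸b%n]%n≡0 b = begin
    (b + (n ∸ b % n)) % n      ≡⟨ sym (%-absorbˡ b _) ⟩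
    (b % n + (n ∸ b % n)) % n  ≡⟨ cong (_% n) (m+[n∸m]≡n (m%n≤n b n)) ⟩
    n % n                      ≡⟨ n%n≡0 n ⟩
    0                          ∎
    where open ≡-Reasoning

  +-%-cancel : ∀ b i → (i + (b + (n ∸ b % n))) % n ≡ i % n
  +-%-cancel b i = begin
    (i + (b + (n ∸ b % n))) % n      ≡⟨ sym (%-absorbʳ i _) ⟩
    (i + (b + (n ∸ b % n)) % n) % n  ≡⟨ cong (λ z → (i + z) % n) (b+[n∸b%n]%n≡0 b) ⟩
    (i + 0) % n                      ≡⟨ cong (_% n) (+-identityʳ i) ⟩
    i % n                            ∎
    where open ≡-Reasoning

  b+pos : ∀ b i → (b + pos b i) % n ≡ i % n
  b+pos b i = begin
    (b + pos b i) % n           ≡⟨ %-absorbʳ b _ ⟩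
    (b + (i + (n ∸ b % n))) % n  ≡⟨ cong (_% n) (x∙yz≈y∙xz b i _) ⟩
    (i + (b + (n ∸ b % n))) % n  ≡⟨ +-%-cancel b i ⟩
    i % n                        ∎
    where open ≡-Reasoning

  pos-b+ : ∀ b s → pos b (b + s) ≡ s % n
  pos-b+ b s = trans (cong (_% n) (trans (+-assoc b s _) (x∙yz≈y∙xz b s _))) (+-%-cancel b s)

  pos-% : ∀ b i → pos b (i % n) ≡ pos b i
  pos-% b i = %-absorbˡ i _

  pos-+ : ∀ b i t → pos b (t + i) ≡ (t + pos b i) % n
  pos-+ b i t = trans (cong (_% n) (+-assoc t i _)) (sym (%-absorbʳ t _))

module _ {n : ℕ} .{{_ : NonZero n}} (G : Subgraph n) where

  EdgeInvariant : ∀ {A : Set} → (Fin n → A) → Set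
  EdgeInvariant Q = ∀ x → G x ≡ true → Q (proj₁ (ends n x)) ≡ Q (proj₂ (ends n x))

  reach-invariant : ∀ {A : Set} {Q : Fin n → A} → EdgeInvariant Q →
    ∀ {u v} → Reach n G u v → Q u ≡ Q v
  reach-invariant inv here = refl
  reach-invariant {Q = Q} inv (step (x , g , ends≡) r) = trans (adjacent ends≡) (reach-invariant inv r)
    where
    along-x : ∀ {p} → ends n x ≡ p → Q (proj₁ p) ≡ Q (proj₂ p)
    along-x eq = subst (λ p → Q (proj₁ p) ≡ Q (proj₂ p)) eq (inv x g)
    adjacent : ∀ {u v} → ends n x ≡ (u , v) ⊎ ends n x ≡ (v , u) → Q u ≡ Q v
    adjacent (inj₁ eq) = along-x eq
    adjacent (inj₂ eq) = sym (along-x eq)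

module SegmentLabel (p q h : ℕ) (1≤p : 1 ≤ p) (p-even : even p ≡ true) (p≤q : p ≤ q) (q≤h : q ≤ h) where

  label : ℕ → Bool
  label zero = false
  label (suc t) with suc t ≤? p
  ... | yes _ = even (suc t)
  ... | no _ with suc t ≤? q
  ...   | yes _ = true
  ...   | no _ with suc t ≤? h
  ...     | yes _ = not (even (suc t) xor even q)
  ...     | no _ = false

  label-left : ∀ {t} → 1 ≤ t → t ≤ p → label t ≡ even t
  label-left {suc t} _ t≤p with suc t ≤? p
  ... | yes _ = refl
  ... | no t≰p = contradiction t≤p t≰p

  label-core : ∀ {t} → p ≤ t → t ≤ q → label t ≡ true
  label-core {zero} p≤0 _ = contradiction (≤-trans 1≤p p≤0) λ ()
  label-core {suc t} p≤t t≤q with suc t ≤? p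
  ... | yes t≤p = trans (cong even (≤-antisym t≤p p≤t)) p-even
  ... | no _ with suc t ≤? q
  ...   | yes _ = refl
  ...   | no t≰q = contradiction t≤q t≰q

  label-above-core : ∀ {t} → q < t → t ≤ h → label t ≡ not (even t xor even q)
  label-above-core {suc t} q<t t≤h with suc t ≤? p
  ... | yes t≤p = contradiction (≤-trans t≤p p≤q) (<⇒≱ q<t)
  ... | no _ with suc t ≤? q
  ...   | yes t≤q = contradiction t≤q (<⇒≱ q<t)
  ...   | no _ with suc t ≤? h
  ...     | yes _ = refl
  ...     | no t≰h = contradiction t≤h t≰h

  label-right : ∀ {t} → q ≤ t → t ≤ h → label t ≡ not (even t xor even q)
  label-right {t} q≤t t≤h with m≤n⇒m<n∨m≡n q≤t
  ... | inj₂ refl = trans (label-core p≤q ≤-refl) (sym (cong not (xor-same (even t))))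
  ... | inj₁ q<t = label-above-core q<t t≤h

  label-beyond : ∀ {t} → h < t → label t ≡ false
  label-beyond {suc t} h<t with suc t ≤? p
  ... | yes t≤p = contradiction (≤-trans t≤p (≤-trans p≤q q≤h)) (<⇒≱ h<t)
  ... | no _ with suc t ≤? q
  ...   | yes t≤q = contradiction (≤-trans t≤q q≤h) (<⇒≱ h<t)
  ...   | no _ with suc t ≤? h
  ...     | yes t≤h = contradiction t≤h (<⇒≱ h<t)
  ...     | no _ = refl

  label-off-parity : ∀ {t} → q ≤ t → even t ≡ not (even q) → label t ≡ false
  label-off-parity {t} q≤t t-parity with <-or-≥ h t
  ... | inj₁ h<t = label-beyond h<t
  ... | inj₂ t≤h = trans (label-right q≤t t≤h)
                     (trans (cong (λ x → not (x xor even q)) t-parity) (not-xor-self (even q)))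
    where
    not-xor-self : ∀ x → not (not x xor x) ≡ false
    not-xor-self true = refl
    not-xor-self false = refl

module Classification {n : ℕ} .{{_ : NonZero n}} (1<n : 1 < n) (G : Subgraph n)
                      (connected : Connected n G) (convex : Convex n G) where

  open Modular n

  E F : ℕ → ℕ → Bool
  E b s = G (e n (b + s))
  F b s = G (f n (b + s))

  E-suc : ∀ b s → E b (suc s) ≡ G (e n (b + s + 1))
  E-suc b s = cong (λ i → G (e n i)) (trans (+-suc b s) (+-comm 1 (b + s)))

  frames⇒window : ∀ b s → E b s ≡ true → E b (suc s) ≡ true → F b s ≡ true
  frames⇒window b s Es Es′ = convex-triangle-closed (convex (b + s)) Es (trans (sym (E-suc b s)) Es′)

  window⇒frames-agree : ∀ b s → F b s ≡ true → E b s ≡ E b (suc s)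
  window⇒frames-agree b s Fs = trans (convex-triangle-agree (convex (b + s)) Fs) (sym (E-suc b s))

  no-window-at-drop : ∀ {b s} → E b s ≡ true → E b (suc s) ≡ false → F b s ≡ false
  no-window-at-drop {b} {s} Es Es′ = ¬-not λ Fs → clash Es (trans (window⇒frames-agree b s Fs) Es′)

  no-window-at-rise : ∀ {b s} → E b s ≡ false → E b (suc s) ≡ true → F b s ≡ false
  no-window-at-rise {b} {s} Es Es′ = ¬-not λ Fs → clash Es′ (trans (sym (window⇒frames-agree b s Fs)) Es)

  E-+ : ∀ b c s → E (b + c) s ≡ E b (c + s)
  E-+ b c s = cong (λ i → G (e n i)) (+-assoc b c s)

  F-+ : ∀ b c s → F (b + c) s ≡ F b (c + s)
  F-+ b c s = cong (λ i → G (f n i)) (+-assoc b c s)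

  +n-% : ∀ b s → (b + (s + n)) % n ≡ (b + s) % n
  +n-% b s = trans (cong (_% n) (sym (+-assoc b s n))) ([m+n]%n≡m%n (b + s) n)

  E-+n : ∀ b s → E b (s + n) ≡ E b s
  E-+n b s = cong (λ v → G (frame v)) (vtx-≡ (+n-% b s))

  F-+n : ∀ b s → F b (s + n) ≡ F b s
  F-+n b s = cong (λ v → G (window v)) (vtx-≡ (+n-% b s))

  E-% : ∀ b s → E (b % n) s ≡ E b s
  E-% b s = cong (λ v → G (frame v)) (vtx-≡ (%-absorbˡ b s))

  vtx-b+pos : ∀ b v → vtx n (b + pos b (toℕ v)) ≡ v
  vtx-b+pos b v = trans (vtx-≡ (b+pos b (toℕ v))) (vtx-toℕ v)

  frame≡e : ∀ b v → frame v ≡ e n (b + pos b (toℕ v))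
  frame≡e b v = cong frame (sym (vtx-b+pos b v))

  window≡f : ∀ b v → window v ≡ f n (b + pos b (toℕ v))
  window≡f b v = cong window (sym (vtx-b+pos b v))

  -- R labels positions seen from b; positions n and n+1 are the vertices v_b and v_{b+1} again.
  label-constant : ∀ b (R : ℕ → Bool) → R n ≡ R 0 → R (suc n) ≡ R 1 →
    (∀ s → E b s ≡ true → R s ≡ R (suc s)) →
    (∀ s → F b s ≡ true → R s ≡ R (suc (suc s))) →
    ∀ s → s < n → R s ≡ R 0
  label-constant b R wrap₀ wrap₁ R-frame R-window s s<n = begin
    R s                  ≡⟨ sym (R-at s s<n) ⟩
    Q (vtx n (b + s))    ≡⟨ reach-invariant G {Q = Q} Q-invariant (connected _ _) ⟩
    Q (vtx n (b + 0))    ≡⟨ R-at 0 (≤-trans (s≤s z≤n) 1<n) ⟩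
    R 0                  ∎
    where
    open ≡-Reasoning
    Q : Fin n → Bool
    Q v = R (pos b (toℕ v))

    R-% : ∀ t → t ≤ suc n → R (t % n) ≡ R t
    R-% t t≤1+n with m≤n⇒m<n∨m≡n t≤1+n
    ... | inj₂ refl = trans (cong R (trans ([m+n]%n≡m%n 1 n) (m<n⇒m%n≡m 1<n))) (sym wrap₁)
    ... | inj₁ t<1+n with m<1+n⇒m<n∨m≡n t<1+n
    ...   | inj₁ t<n = cong R (m<n⇒m%n≡m t<n)
    ...   | inj₂ refl = trans (cong R (n%n≡0 n)) (sym wrap₀)

    R-at : ∀ s → s < n → Q (vtx n (b + s)) ≡ R s
    R-at s s<n = cong R (trans (cong (pos b) (toℕ-vtx (b + s)))
                     (trans (pos-% b (b + s)) (trans (pos-b+ b s) (m<n⇒m%n≡m s<n))))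

    step-label : ∀ v t → t ≤ 2 → Q (vtx n (toℕ v + t)) ≡ R (t + pos b (toℕ v))
    step-label v t t≤2 = begin
      R (pos b (toℕ (vtx n (toℕ v + t))))  ≡⟨ cong R (trans (cong (pos b) (toℕ-vtx _)) (pos-% b _)) ⟩
      R (pos b (toℕ v + t))                ≡⟨ cong (λ i → R (pos b i)) (+-comm (toℕ v) t) ⟩
      R (pos b (t + toℕ v))                ≡⟨ cong R (pos-+ b (toℕ v) t) ⟩
      R ((t + pos b (toℕ v)) % n)          ≡⟨ R-% _ (≤-trans (+-monoˡ-≤ (pos b (toℕ v)) t≤2)
                                                              (s≤s (pos<n b (toℕ v)))) ⟩
      R (t + pos b (toℕ v))                ∎

    Q-invariant : EdgeInvariant G Q
    Q-invariant (frame v) g =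
      trans (R-frame _ (trans (cong G (sym (frame≡e b v))) g)) (sym (step-label v 1 (s≤s z≤n)))
    Q-invariant (window v) g =
      trans (R-window _ (trans (cong G (sym (window≡f b v))) g)) (sym (step-label v 2 ≤-refl))

  -- The conditions say that no edge of G leaves the set of vertices v_{b+t} with p ≤ t ≤ q,
  -- or 1 ≤ t ≤ p and t even, or q ≤ t ≤ h and t ≡ q (mod 2).
  record Separator (b p q h : ℕ) : Set where
    field
      1≤p              : 1 ≤ p
      p-even           : even p ≡ true
      p≤q              : p ≤ q
      q≤h              : q ≤ h
      h-parity         : even h ≡ even q
      h<n              : h < n
      left-gap         : ∀ s → 1 ≤ s → s < p → E b s ≡ false
      right-gap        : ∀ s → q ≤ s → s ≤ h → E b s ≡ false
      no-window₀       : F b 0 ≡ false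
      no-windowₕ       : F b h ≡ false
      no-inner-windows : p < q → F b (pred p) ≡ false × F b (pred q) ≡ false

  module _ {b p q h : ℕ} (sep : Separator b p q h) where
    open Separator sep
    open SegmentLabel p q h 1≤p p-even p≤q q≤h

    separator-frames-respect : ∀ s → E b s ≡ true → label s ≡ label (suc s)
    separator-frames-respect zero _ = sym (label-left ≤-refl 1≤p)
    separator-frames-respect (suc s) Es with <-or-≥ (suc s) p
    ... | inj₁ s<p = clash Es (left-gap (suc s) (s≤s z≤n) s<p)
    ... | inj₂ p≤s with <-or-≥ (suc s) q
    ...   | inj₁ s<q = trans (label-core p≤s (<⇒≤ s<q)) (sym (label-core (m≤n⇒m≤1+n p≤s) s<q))
    ...   | inj₂ q≤s with <-or-≥ h (suc s)
    ...     | inj₂ s≤h = clash Es (right-gap (suc s) q≤s s≤h)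
    ...     | inj₁ h<s = trans (label-beyond h<s) (sym (label-beyond (m<n⇒m<1+n h<s)))

    separator-windows-respect-from-p : ∀ s → p ≤ s → F b s ≡ true → label s ≡ label (suc (suc s))
    separator-windows-respect-from-p s p≤s Fs with straddle s q
    ... | lies-below s+2≤q = trans (label-core p≤s (≤-trans (n≤1+n _) (≤-trans (n≤1+n _) s+2≤q)))
                                   (sym (label-core (≤-trans p≤s (≤-trans (n≤1+n _) (n≤1+n _))) s+2≤q))
    ... | crosses s+1≡q =
      clash Fs (subst (λ x → F b (pred x) ≡ false) (sym s+1≡q) (proj₂ (no-inner-windows p<q)))
      where
      p<q : p < q
      p<q = subst (suc p ≤_) s+1≡q (s≤s p≤s)
    ... | lies-above q≤s with straddle s h
    ...   | lies-below s+2≤h = trans (label-right q≤s (≤-trans (n≤1+n _) (≤-trans (n≤1+n _) s+2≤h)))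
                                   (sym (label-right q≤s+2 s+2≤h))
      where
      q≤s+2 : q ≤ suc (suc s)
      q≤s+2 = ≤-trans q≤s (≤-trans (n≤1+n _) (n≤1+n _))
    ...   | crosses s+1≡h = trans (label-off-parity q≤s parity) (sym (label-off-parity q≤s+2 parity))
      where
      parity : even s ≡ not (even q)
      parity = even-pred s (trans (cong even s+1≡h) h-parity)
      q≤s+2 : q ≤ suc (suc s)
      q≤s+2 = ≤-trans q≤s (≤-trans (n≤1+n _) (n≤1+n _))
    ...   | lies-above h≤s with m≤n⇒m<n∨m≡n h≤s
    ...     | inj₂ h≡s = clash Fs (subst (λ x → F b x ≡ false) h≡s no-windowₕ)
    ...     | inj₁ h<s = trans (label-beyond h<s) (sym (label-beyond (≤-trans h<s (≤-trans (n≤1+n _) (n≤1+n _)))))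

    separator-windows-respect : ∀ s → F b s ≡ true → label s ≡ label (suc (suc s))
    separator-windows-respect zero F0 = clash F0 no-window₀
    separator-windows-respect (suc s) Fs with straddle (suc s) p
    ... | lies-below s+3≤p = trans (label-left (s≤s z≤n) (≤-trans (n≤1+n _) (≤-trans (n≤1+n _) s+3≤p)))
                                   (sym (label-left (s≤s z≤n) s+3≤p))
    ... | lies-above p≤s+1 = separator-windows-respect-from-p (suc s) p≤s+1 Fs
    ... | crosses s+2≡p with <-or-≥ p q
    ...   | inj₁ p<q = clash Fs (subst (λ x → F b (pred x) ≡ false) (sym s+2≡p) (proj₁ (no-inner-windows p<q)))
    ...   | inj₂ q≤p = trans (label-left (s≤s z≤n) (subst (suc s ≤_) s+2≡p (n≤1+n _)))
                         (trans (even-pred (suc s) (trans (cong even s+2≡p) p-even))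
                                (sym (label-off-parity q≤s+3 parity)))
      where
      parity : even (suc s) ≡ not (even q)
      parity = even-pred (suc s) (trans (cong even s+2≡p) (cong even (≤-antisym p≤q q≤p)))
      q≤s+3 : q ≤ suc (suc (suc s))
      q≤s+3 = ≤-trans q≤p (subst (_≤ suc (suc (suc s))) s+2≡p (n≤1+n _))

    separator-impossible : ⊥
    separator-impossible = clash (trans (sym label-p≡label-0) (label-core ≤-refl p≤q)) refl
      where
      label-p≡label-0 : label p ≡ label 0
      label-p≡label-0 = label-constant b label (label-beyond h<n)
        (trans (label-beyond (m<n⇒m<1+n h<n)) (sym (label-left ≤-refl 1≤p)))
        separator-frames-respect separator-windows-respect p (≤-<-trans (≤-trans p≤q q≤h) h<n)

  even-gap-impossible : ∀ {b h} → 1 ≤ h → even h ≡ true → h < n →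
    (∀ s → 1 ≤ s → s ≤ h → E b s ≡ false) → F b 0 ≡ false → F b h ≡ false → ⊥
  even-gap-impossible {b} {h} 1≤h h-even h<n gap F0 Fh = separator-impossible {b} {h} {h} {h} record
    { 1≤p = 1≤h ; p-even = h-even ; p≤q = ≤-refl ; q≤h = ≤-refl ; h-parity = refl ; h<n = h<n
    ; left-gap = λ s 1≤s s<h → gap s 1≤s (<⇒≤ s<h)
    ; right-gap = λ s h≤s s≤h → gap s (≤-trans 1≤h h≤s) s≤h
    ; no-window₀ = F0 ; no-windowₕ = Fh
    ; no-inner-windows = λ h<h → contradiction h<h (<-irrefl refl)
    }

  no-frames-even-impossible : (∀ v → G (frame v) ≡ false) → even n ≡ true → ⊥
  no-frames-even-impossible no-frame n-even =
    clash (label-constant 0 even n-even (trans (even-suc n) (cong not n-even))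
             (λ s Es → clash Es (no-frame _)) (λ _ _ → refl) 1 1<n) refl

  record Gap (b m : ℕ) : Set where
    field
      1≤m    : 1 ≤ m
      m<n    : m < n
      before : E b 0 ≡ true
      inside : ∀ t → 1 ≤ t → t ≤ m → E b t ≡ false
      after  : E b (suc m) ≡ true

  module _ {b m : ℕ} (g : Gap b m) where
    open Gap g

    gap-window₀ : F b 0 ≡ false
    gap-window₀ = no-window-at-drop before (inside 1 ≤-refl 1≤m)

    gap-windowₘ : F b m ≡ false
    gap-windowₘ = no-window-at-rise (inside m 1≤m ≤-refl) after

    gap-odd : even m ≡ false
    gap-odd with even m in m-parity
    ... | false = refl
    ... | true = ⊥-elim (even-gap-impossible 1≤m m-parity m<n inside gap-window₀ gap-windowₘ)

    gap-windows : ∀ t → 1 ≤ t → t < m → F b t ≡ true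
    gap-windows t 1≤t t<m with F b t in Ft
    ... | true = refl
    ... | false with even t in t-parity
    ...   | true = ⊥-elim (even-gap-impossible 1≤t t-parity (<-trans t<m m<n)
                     (λ s 1≤s s≤t → inside s 1≤s (≤-trans s≤t (<⇒≤ t<m))) gap-window₀ Ft)
    ...   | false = ⊥-elim (even-gap-impossible {b + t} {m ∸ t} (m<n⇒0<n∸m t<m)
                      (even-∸ (<⇒≤ t<m) (trans t-parity (sym gap-odd))) (≤-<-trans (m∸n≤m m t) m<n)
                      shifted-gap (trans (F-+ b t 0) (trans (cong (F b) (+-identityʳ t)) Ft))
                      (trans (F-+ b t (m ∸ t)) (trans (cong (F b) t+[m∸t]≡m) gap-windowₘ)))
      where
      t+[m∸t]≡m : t + (m ∸ t) ≡ m
      t+[m∸t]≡m = m+[n∸m]≡n (<⇒≤ t<m)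
      shifted-gap : ∀ s → 1 ≤ s → s ≤ m ∸ t → E (b + t) s ≡ false
      shifted-gap s 1≤s s≤m∸t = trans (E-+ b t s)
        (inside (t + s) (≤-trans 1≤s (m≤n+m s t)) (≤-trans (+-monoʳ-≤ t s≤m∸t) (≤-reflexive t+[m∸t]≡m)))

  gap-from : ∀ {c} L → L < n → E c 0 ≡ true → E c 1 ≡ false → E c (suc L) ≡ true →
    ∃ λ m → m ≤ L × Gap c m
  gap-from {c} L L<n E0 E1 E-end with least-counterexample (λ t → E c (suc t) Bool.≟ false) (suc L)
  ... | inj₁ absent = clash E-end (absent L ≤-refl)
  ... | inj₂ (zero , _ , present , _) = contradiction E1 present
  ... | inj₂ (suc k , k<1+L , present , absent) = suc k , s≤s⁻¹ k<1+L , record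
    { 1≤m = s≤s z≤n ; m<n = ≤-<-trans (s≤s⁻¹ k<1+L) L<n ; before = E0
    ; inside = λ { (suc t) _ t<1+k → absent t t<1+k } ; after = ¬-not present }

  two-gaps-impossible : ∀ {b m d m′} → Gap b m → Gap (b + d) m′ → m < d → d + m′ < n → ⊥
  two-gaps-impossible {b} {m} {d} {m′} g₁ g₂ m<d end<n = separator-impossible {b} {suc m} {suc d} {d + m′} record
    { 1≤p = s≤s z≤n
    ; p-even = trans (even-suc m) (cong not (gap-odd g₁))
    ; p≤q = s≤s (<⇒≤ m<d)
    ; q≤h = subst (_≤ d + m′) (+-comm d 1) (+-monoʳ-≤ d (Gap.1≤m g₂))
    ; h-parity = even-+-odd d (gap-odd g₂)
    ; h<n = end<n
    ; left-gap = λ s 1≤s s<1+m → Gap.inside g₁ s 1≤s (s≤s⁻¹ s<1+m)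
    ; right-gap = right-gap
    ; no-window₀ = gap-window₀ g₁
    ; no-windowₕ = trans (sym (F-+ b d m′)) (gap-windowₘ g₂)
    ; no-inner-windows = λ _ → gap-windowₘ g₁ ,
        trans (cong (F b) (sym (+-identityʳ d))) (trans (sym (F-+ b d 0)) (gap-window₀ g₂))
    }
    where
    right-gap : ∀ s → suc d ≤ s → s ≤ d + m′ → E b s ≡ false
    right-gap s d<s s≤d+m′ = begin
      E b s              ≡⟨ cong (E b) (sym (m+[n∸m]≡n (<⇒≤ d<s))) ⟩
      E b (d + (s ∸ d))  ≡⟨ sym (E-+ b d (s ∸ d)) ⟩
      E (b + d) (s ∸ d)  ≡⟨ Gap.inside g₂ (s ∸ d) (m<n⇒0<n∸m d<s)
                              (≤-trans (∸-monoˡ-≤ d s≤d+m′) (≤-reflexive (m+n∸m≡n d m′))) ⟩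
      false              ∎
      where open ≡-Reasoning

  no-second-drop : ∀ {a m d} → Gap a m → m < d → d < n → E a d ≡ true → E a (suc d) ≡ false → ⊥
  no-second-drop {a} {m} {d} g m<d d<n Ed Ed+1 =
    let (m′ , m′≤L , g₂) = gap-from {a + d} L L<n E0 E1 E-end
    in two-gaps-impossible g g₂ m<d (≤-trans (+-monoʳ-< d (s≤s m′≤L)) (≤-reflexive d+[1+L]≡n))
    where
    L : ℕ
    L = n ∸ suc d
    d+[1+L]≡n : d + suc L ≡ n
    d+[1+L]≡n = trans (+-suc d L) (m+[n∸m]≡n d<n)
    L<n : L < n
    L<n = ≤-trans (m≤n+m (suc L) d) (≤-reflexive d+[1+L]≡n)
    E0 : E (a + d) 0 ≡ true
    E0 = trans (E-+ a d 0) (trans (cong (E a) (+-identityʳ d)) Ed)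
    E1 : E (a + d) 1 ≡ false
    E1 = trans (E-+ a d 1) (trans (cong (E a) (+-comm d 1)) Ed+1)
    E-end : E (a + d) (suc L) ≡ true
    E-end = trans (E-+ a d (suc L)) (trans (cong (E a) d+[1+L]≡n) (trans (E-+n a 0) (Gap.before g)))

  frames-present-after-gap : ∀ {a m} → Gap a m → ∀ t → m < t → t < n → E a t ≡ true
  frames-present-after-gap {a} {m} g t m<t t<n
    with least-counterexample (λ u → E a (suc m + u) Bool.≟ true) (n ∸ suc m)
  ... | inj₁ present = subst (λ x → E a x ≡ true) (m+[n∸m]≡n m<t) (present (t ∸ suc m) (∸-monoˡ-< t<n m<t))
  ... | inj₂ (zero , _ , absent , _) =
    contradiction (trans (cong (E a) (+-identityʳ (suc m))) (Gap.after g)) absent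
  ... | inj₂ (suc c , c<n∸[1+m] , absent , present) =
    ⊥-elim (no-second-drop g (s≤s (m≤m+n m c)) d<n (present c ≤-refl)
      (trans (cong (E a) (sym (+-suc (suc m) c))) (¬-not absent)))
    where
    d<n : suc m + c < n
    d<n = ≤-trans (+-monoʳ-< (suc m) (<⇒≤ c<n∸[1+m])) (≤-reflexive (m+[n∸m]≡n (<-trans m<t t<n)))

  E-toℕ : ∀ v → E (toℕ v) 0 ≡ G (frame v)
  E-toℕ v = cong (λ x → G (frame x)) (trans (cong (vtx n) (+-identityʳ (toℕ v))) (vtx-toℕ v))

  F-toℕ : ∀ v → F (toℕ v) 0 ≡ G (window v)
  F-toℕ v = cong (λ x → G (window x)) (trans (cong (vtx n) (+-identityʳ (toℕ v))) (vtx-toℕ v))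

  frame-drop : ∀ {u v} → G (frame u) ≡ true → G (frame v) ≡ false →
    ∃ λ a → a < n × E a 0 ≡ true × E a 1 ≡ false
  frame-drop {u} {v} present absent with least-counterexample (λ t → E (toℕ u) t Bool.≟ true) n
  ... | inj₁ all-present =
    clash (trans (cong G (frame≡e (toℕ u) v)) (all-present _ (pos<n (toℕ u) (toℕ v)))) absent
  ... | inj₂ (zero , _ , ¬E0 , _) = contradiction (trans (E-toℕ u) present) ¬E0
  ... | inj₂ (suc k , _ , ¬Ek+1 , below) = (toℕ u + k) % n , m%n<n _ n ,
    trans (E-% _ 0) (trans (E-+ (toℕ u) k 0) (trans (cong (E (toℕ u)) (+-identityʳ k)) (below k ≤-refl))) ,
    trans (E-% _ 1) (trans (E-+ (toℕ u) k 1) (trans (cong (E (toℕ u)) (+-comm k 1)) (¬-not ¬Ek+1)))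

  IsS-intro : ∀ {a} k → let m = k + k + 1 in m ≤ n →
    (∀ t → 1 ≤ t → t ≤ m → E a t ≡ false) →
    (∀ t → m < t → t ≤ n → E a t ≡ true) →
    (∀ t → 1 ≤ t → t < m → F a t ≡ true) →
    F a 0 ≡ false → F a m ≡ false → IsS n k a G
  IsS-intro {a} k m≤n absent present inner F0 Fm x = present⇒kept x , kept⇒present x
    where
    m : ℕ
    m = k + k + 1
    f-a : f n a ≡ f n (a + 0)
    f-a = cong (f n) (sym (+-identityʳ a))

    present⇒kept : ∀ x → G x ≡ true → ¬ RemovedS n k a x
    present⇒kept x g (inj₁ refl) = clash (trans (cong G (sym f-a)) g) F0
    present⇒kept x g (inj₂ (inj₁ refl)) = clash g Fm
    present⇒kept x g (inj₂ (inj₂ (t , 1≤t , t≤m , refl))) = clash g (absent t 1≤t t≤m)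

    frame-kept : ∀ s → s < n → ¬ RemovedS n k a (e n (a + s)) → E a s ≡ true
    frame-kept zero _ kept with m≤n⇒m<n∨m≡n m≤n
    ... | inj₁ m<n = trans (sym (E-+n a 0)) (present n m<n ≤-refl)
    ... | inj₂ m≡n = contradiction (inj₂ (inj₂ (m , m≤n+m 1 (k + k) , ≤-refl ,
                        cong frame (vtx-≡ (sym (trans (cong (λ t → (a + t) % n) m≡n) (+n-% a 0))))))) kept
    frame-kept (suc s) s<n kept with <-or-≥ m (suc s)
    ... | inj₁ m<s = present (suc s) m<s (<⇒≤ s<n)
    ... | inj₂ s≤m = contradiction (inj₂ (inj₂ (suc s , s≤s z≤n , s≤m , refl))) kept

    window-kept : ∀ s → s < n → ¬ RemovedS n k a (f n (a + s)) → F a s ≡ true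
    window-kept zero _ kept = contradiction (inj₁ (sym f-a)) kept
    window-kept (suc s) s<n kept with <-cmp (suc s) m
    ... | tri< s<m _ _ = inner (suc s) (s≤s z≤n) s<m
    ... | tri≈ _ s≡m _ = contradiction (inj₂ (inj₁ (cong (λ t → f n (a + t)) s≡m))) kept
    ... | tri> _ _ m<s =
      frames⇒window a (suc s) (present (suc s) m<s (<⇒≤ s<n)) (present (suc (suc s)) (m<n⇒m<1+n m<s) s<n)

    kept⇒present : ∀ x → ¬ RemovedS n k a x → G x ≡ true
    kept⇒present (frame v) kept = trans (cong G (frame≡e a v))
      (frame-kept _ (pos<n a (toℕ v)) λ r → kept (subst (RemovedS n k a) (sym (frame≡e a v)) r))
    kept⇒present (window v) kept = trans (cong G (window≡f a v))
      (window-kept _ (pos<n a (toℕ v)) λ r → kept (subst (RemovedS n k a) (sym (window≡f a v)) r))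

  IsSomeS : Set
  IsSomeS = Σ ℕ λ j → Σ ℕ λ k → j < n × k ≤ ⌈ (n ∸ 2) /2⌉ × IsS n k j G

  all-frames⇒full : (∀ v → G (frame v) ≡ true) → G ≐ fullGraph n
  all-frames⇒full all-frames (frame v) = all-frames v
  all-frames⇒full all-frames (window v) = trans (sym (F-toℕ v))
    (frames⇒window (toℕ v) 0 (trans (E-toℕ v) (all-frames v)) (all-frames _))

  gap⇒S : ∀ {a m} → a < n → Gap a m → IsSomeS
  gap⇒S {a} {m} a<n g with even≡false⇒odd m (gap-odd g)
  ... | k , refl = a , k , a<n , k≤⌈[n∸2]/2⌉ (subst (_≤ n) (+-comm (k + k) 1) (<⇒≤ m<n)) ,
        IsS-intro k (<⇒≤ m<n) inside frames-after (gap-windows g) (gap-window₀ g) (gap-windowₘ g)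
    where
    open Gap g
    frames-after : ∀ t → k + k + 1 < t → t ≤ n → E a t ≡ true
    frames-after t m<t t≤n with m≤n⇒m<n∨m≡n t≤n
    ... | inj₁ t<n = frames-present-after-gap g t m<t t<n
    ... | inj₂ refl = trans (E-+n a 0) before

  1+[n∸1]≡n : suc (n ∸ 1) ≡ n
  1+[n∸1]≡n = m+[n∸m]≡n (<⇒≤ 1<n)

  mixed-frames : ∀ {u v} → G (frame u) ≡ true → G (frame v) ≡ false → IsSomeS
  mixed-frames present absent with frame-drop present absent
  ... | a , a<n , E0 , E1 with gap-from (n ∸ 1) (≤-reflexive 1+[n∸1]≡n) E0 E1
                                 (trans (cong (E a) 1+[n∸1]≡n) (trans (E-+n a 0) E0))
  ...   | _ , _ , g = gap⇒S a<n g

  lone-missing-window : (∀ v → G (frame v) ≡ false) → even n ≡ false →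
    ∀ {b} → F b 0 ≡ false → ∀ t → 1 ≤ t → t < n → F b t ≡ true
  lone-missing-window no-frame n-odd {b} F0 t 1≤t t<n with F b t in Ft
  ... | true = refl
  ... | false with even t in t-parity
  ...   | true = ⊥-elim (even-gap-impossible 1≤t t-parity t<n (λ _ _ _ → no-frame _) F0 Ft)
  ...   | false = ⊥-elim (even-gap-impossible {b + t} {n ∸ t} (m<n⇒0<n∸m t<n)
                    (even-∸ (<⇒≤ t<n) (trans t-parity (sym n-odd))) (∸-monoʳ-< 1≤t (<⇒≤ t<n))
                    (λ _ _ _ → no-frame _) (trans (F-+ b t 0) (trans (cong (F b) (+-identityʳ t)) Ft))
                    (trans (F-+ b t (n ∸ t)) (trans (cong (F b) (m+[n∸m]≡n (<⇒≤ t<n))) (trans (F-+n b 0) F0))))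

  missing-window⇒S : (∀ v → G (frame v) ≡ false) → even n ≡ false →
    ∀ {v} → G (window v) ≡ false → IsSomeS
  missing-window⇒S no-frame n-odd {v} missing with even≡false⇒odd n n-odd
  ... | k , n≡m =
    toℕ v , k , toℕ<n v , k≤⌈[n∸2]/2⌉ (subst (_≤ n) (+-comm (k + k) 1) (≤-reflexive (sym n≡m))) ,
    IsS-intro k (≤-reflexive (sym n≡m)) (λ _ _ _ → no-frame _)
      (λ t m<t t≤n → contradiction t≤n (<⇒≱ (subst (_< t) (sym n≡m) m<t)))
      (λ t 1≤t t<m → lone-missing-window no-frame n-odd F0 t 1≤t (subst (t <_) (sym n≡m) t<m))
      F0 (trans (cong (F (toℕ v)) (sym n≡m)) (trans (F-+n (toℕ v) 0) F0))
    where
    F0 : F (toℕ v) 0 ≡ false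
    F0 = trans (F-toℕ v) missing

  no-frames : ¬ (Odd n × G ≐ windowsOnly n) → (∀ v → G (frame v) ≡ false) → IsSomeS
  no-frames not-windows-only no-frame with even n in n-parity
  ... | true = ⊥-elim (no-frames-even-impossible no-frame n-parity)
  ... | false with all? (λ v → G (window v) Bool.≟ true)
  ...   | yes all-windows = ⊥-elim (not-windows-only (n-odd , windows-only))
    where
    n-odd : Odd n
    n-odd = let (k , n≡m) = even≡false⇒odd n n-parity in k , trans n≡m (+-comm (k + k) 1)
    windows-only : G ≐ windowsOnly n
    windows-only (frame v) = no-frame v
    windows-only (window v) = all-windows v
  ...   | no ¬all-windows = missing-window⇒S no-frame n-parity
          (¬-not (proj₂ (¬∀⟶∃¬ n _ (λ v → G (window v) Bool.≟ true) ¬all-windows)))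

  classify : ¬ (G ≐ fullGraph n) → ¬ (Odd n × G ≐ windowsOnly n) → IsSomeS
  classify not-full not-windows-only with all? (λ v → G (frame v) Bool.≟ true)
  ... | yes all-frames = ⊥-elim (not-full (all-frames⇒full all-frames))
  ... | no ¬all-frames with any? (λ v → G (frame v) Bool.≟ true)
  ...   | yes (_ , present) =
    mixed-frames present (¬-not (proj₂ (¬∀⟶∃¬ n _ (λ v → G (frame v) Bool.≟ true) ¬all-frames)))
  ...   | no none = no-frames not-windows-only (λ v → ¬-not λ present → none (v , present))

theorem3p4 : (n : ℕ) .{{_ : NonZero n}} → 5 ≤ n → (G : Subgraph n) →
    Nontrivial n G → Connected n G → Convex n G →
    Σ ℕ λ j → Σ ℕ λ k → j < n × k ≤ ⌈ (n ∸ 2) /2⌉ × IsS n k j G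
theorem3p4 n n≥5 G (not-full , not-windows-only) connected convex =
  Classification.classify (≤-trans (s≤s (s≤s z≤n)) n≥5) G connected convex not-full not-windows-only
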